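{- Let $U$ be a 1-dimensional subspace of $\mathrm{GF}(q)$ over $\mathrm{GF}(p)$. Then $P\not\cong S_{U,W}\not\cong E$.
   Context: Let $q=p^f$ with $p$ prime and $f\geq 2$. For $a,b,c\in\mathrm{GF}(q)$ let $t_{a,b,c}$ be the $4\times 4$ matrix with rows $(1,0,0,0)$, $(-c,1,0,0)$, $(b,0,1,0)$, $(a,b,c,1)$; $E:=\{t_{a,b,c}\}$, $R:=\{t_{a,b,0}\}$. For $\alpha\in\mathrm{GF}(q)$ let $\theta_{\alpha}$ be the matrix with rows $(1,0,0,0)$, $(-\alpha,1,0,0)$, $(-\alpha^2,\alpha,1,0)$, $(0,0,\alpha,1)$. For a basis $\{\alpha_1,\ldots,\alpha_f\}$ of $\mathrm{GF}(q)$ over $\mathrm{GF}(p)$ let $P:=\langle R,\theta_{\alpha_1},\ldots,\theta_{\alpha_f}\rangle$. For a decomposition $\mathrm{GF}(q)=U\oplus W$ into $\mathrm{GF}(p)$-subspaces with $U$ having basis $\{\alpha_1,\ldots,\alpha_k\}$, let $S_{U,W}:=\langle R,\theta_{\alpha_1},\ldots,\theta_{\alpha_k},t_{0,0,w}\mid w\in W\rangle$. -}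

module Defs where

open import Level using (Level; _⊔_)
open import Data.Nat using (ℕ; zero; suc)
open import Data.Fin using (Fin; zero; suc)
open import Data.Product using (Σ; ∃; ∃-syntax; _×_; _,_)
open import Data.Sum using (_⊎_)
open import Relation.Nullary using (¬_)
open import Relation.Binary.PropositionalEquality using (_≡_)
open import Algebra.Bundles using (CommutativeRing)

record Field (c ℓ : Level) : Set (Level.suc (c ⊔ ℓ)) where
  field
    commRing : CommutativeRing c ℓ
  open CommutativeRing commRing public using (Carrier; _≈_; _+_; _*_; -_; 0#; 1#)
  field
    1≉0     : ¬ (1# ≈ 0#)
    inverse : ∀ x → ¬ (x ≈ 0#) → ∃[ y ] (x * y ≈ 1#)

module _ {c ℓ : Level} (F : Field c ℓ) where
  open Field F

  HasSize : ℕ → Set (c ⊔ ℓ)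
  HasSize n = Σ (Carrier → Fin n) λ to → Σ (Fin n → Carrier) λ from →
                (∀ {x y} → x ≈ y → to x ≡ to y) ×
                (∀ x → from (to x) ≈ x) ×
                (∀ i → to (from i) ≡ i)

  -- action of the prime field: k · x = x + ... + x (k times)
  _·_ : ℕ → Carrier → Carrier
  zero  · x = 0#
  suc k · x = x + (k · x)

  ∑ : (n : ℕ) → (Fin n → Carrier) → Carrier
  ∑ zero    g = 0#
  ∑ (suc n) g = g zero + ∑ n (λ i → g (suc i))

  -- GF(p)-linear combination of a family α with coefficients in GF(p) ≅ Fin p
  lincomb : (p f : ℕ) → (Fin f → Carrier) → (Fin f → Fin p) → Carrier
  lincomb p f α coef = ∑ f (λ i → Data.Fin.toℕ (coef i) · α i)

  IsBasis : (p f : ℕ) → (Fin f → Carrier) → Set (c ⊔ ℓ)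
  IsBasis p f α =
    (∀ coef → lincomb p f α coef ≈ 0# → ∀ i → Data.Fin.toℕ (coef i) ≡ 0) ×
    (∀ x → ∃[ coef ] (x ≈ lincomb p f α coef))

  IsSubspace : (Carrier → Set ℓ) → Set (c ⊔ ℓ)
  IsSubspace W =
    (∀ {x y} → x ≈ y → W x → W y) ×
    W 0# ×
    (∀ {x y} → W x → W y → W (x + y)) ×
    (∀ {x} → W x → W (- x)) ×
    (∀ k {x} → W x → W (k · x))

  Span1 : ℕ → Carrier → Carrier → Set ℓ
  Span1 p u x = ∃[ k ] (x ≈ Data.Fin.toℕ {p} k · u)

  IsDirectSum : (Carrier → Set ℓ) → (Carrier → Set ℓ) → Set (c ⊔ ℓ)
  IsDirectSum U W =
    (∀ x → ∃[ u ] ∃[ w ] (U u × W w × x ≈ u + w)) ×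
    (∀ {u w} → U u → W w → u + w ≈ 0# → (u ≈ 0# × w ≈ 0#))

  Mat : Set c
  Mat = Fin 4 → Fin 4 → Carrier

  _≈M_ : Mat → Mat → Set ℓ
  A ≈M B = ∀ i j → A i j ≈ B i j

  _⊗_ : Mat → Mat → Mat
  (A ⊗ B) i j = ∑ 4 (λ k → A i k * B k j)

  I₄ : Mat
  I₄ i j with i Data.Fin.≟ j
  ... | Relation.Nullary.yes _ = 1#
  ... | Relation.Nullary.no  _ = 0#

  rows : (r₀ r₁ r₂ r₃ : Fin 4 → Carrier) → Mat
  rows r₀ r₁ r₂ r₃ zero                   = r₀
  rows r₀ r₁ r₂ r₃ (suc zero)             = r₁
  rows r₀ r₁ r₂ r₃ (suc (suc zero))       = r₂
  rows r₀ r₁ r₂ r₃ (suc (suc (suc zero))) = r₃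

  row : Carrier → Carrier → Carrier → Carrier → Fin 4 → Carrier
  row a b c d zero                   = a
  row a b c d (suc zero)             = b
  row a b c d (suc (suc zero))       = c
  row a b c d (suc (suc (suc zero))) = d

  t : Carrier → Carrier → Carrier → Mat
  t a b c = rows (row 1# 0# 0# 0#) (row (- c) 1# 0# 0#) (row b 0# 1# 0#) (row a b c 1#)

  θ : Carrier → Mat
  θ α = rows (row 1# 0# 0# 0#) (row (- α) 1# 0# 0#) (row (- (α * α)) α 1# 0#) (row 0# 0# α 1#)

  MSet : Set (Level.suc (c ⊔ ℓ))
  MSet = Mat → Set (c ⊔ ℓ)

  data ⟨_⟩ {a : Level} (X : Mat → Set a) : Mat → Set (c ⊔ ℓ ⊔ a) where
    gen  : ∀ {M} → X M → ⟨ X ⟩ M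
    one  : ⟨ X ⟩ I₄
    mul  : ∀ {M N} → ⟨ X ⟩ M → ⟨ X ⟩ N → ⟨ X ⟩ (M ⊗ N)
    inv  : ∀ {M N} → ⟨ X ⟩ M → (M ⊗ N) ≈M I₄ → (N ⊗ M) ≈M I₄ → ⟨ X ⟩ N
    resp : ∀ {M N} → M ≈M N → ⟨ X ⟩ M → ⟨ X ⟩ N

  _∪_ : ∀ {a b} → (Mat → Set a) → (Mat → Set b) → (Mat → Set (a ⊔ b))
  (X ∪ Y) M = X M ⊎ Y M

  E : MSet
  E M = ∃[ a ] ∃[ b ] ∃[ c ] (t a b c ≈M M)

  R : MSet
  R M = ∃[ a ] ∃[ b ] (t a b 0# ≈M M)

  P : (f : ℕ) → (Fin f → Carrier) → Mat → Set (c ⊔ ℓ)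
  P f α = ⟨ R ∪ (λ M → ∃[ i ] (θ (α i) ≈M M)) ⟩

  -- S_{U,W} = ⟨ R, θ_{u₁}, …, θ_{u_k}, t_{0,0,w} (w ∈ W) ⟩ where u is a basis of U
  S : (k : ℕ) → (Fin k → Carrier) → (Carrier → Set ℓ) → Mat → Set (c ⊔ ℓ)
  S k u W = ⟨ R ∪ ((λ M → ∃[ i ] (θ (u i) ≈M M)) ∪ (λ M → ∃[ w ] (W w × t 0# 0# w ≈M M))) ⟩

  -- E as a subgroup (it is already closed; we use E itself as the group)
  -- Group isomorphism between two subgroups G, H of GL₄(F) given as predicates
  -- on matrices, with the group law matrix multiplication and equality ≈M.
  Iso : ∀ {a b} → (Mat → Set a) → (Mat → Set b) → Set (c ⊔ ℓ ⊔ a ⊔ b)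
  Iso G H =
    Σ (Σ Mat G → Σ Mat H) λ φ → Σ (Σ Mat H → Σ Mat G) λ ψ →
      (∀ x y → Data.Product.proj₁ x ≈M Data.Product.proj₁ y →
               Data.Product.proj₁ (φ x) ≈M Data.Product.proj₁ (φ y)) ×
      (∀ x y → Data.Product.proj₁ x ≈M Data.Product.proj₁ y →
               Data.Product.proj₁ (ψ x) ≈M Data.Product.proj₁ (ψ y)) ×
      (∀ x → Data.Product.proj₁ (ψ (φ x)) ≈M Data.Product.proj₁ x) ×
      (∀ y → Data.Product.proj₁ (φ (ψ y)) ≈M Data.Product.proj₁ y) ×
      (∀ x y xy → Data.Product.proj₁ xy ≈M (Data.Product.proj₁ x ⊗ Data.Product.proj₁ y) →
         Data.Product.proj₁ (φ xy) ≈M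
           (Data.Product.proj₁ (φ x) ⊗ Data.Product.proj₁ (φ y)))

module Submission where

open import Defs
open import Level using (Level)
open import Data.Nat using (ℕ; _≤_; _^_)
open import Data.Nat.Primality using (Prime)
open import Data.Fin using (Fin)
open import Data.Product using (_×_)
open import Relation.Nullary using (¬_)

open import Level using (_⊔_)
open import Data.Nat as ℕ using (zero; suc; s≤s; z≤n)
open import Data.Nat.Properties using (+-suc; *-identityʳ; ^-monoʳ-<; ≤-refl)
open import Data.Nat.Primality using (¬prime[0]; ¬prime[1])
open import Data.Integer as ℤ using (ℤ; +_; -[1+_]; _⊖_; _◃_)
import Data.Integer.Properties as ℤ
import Data.Sign as Sign
open import Data.Fin using (zero; suc; #_)
import Data.Fin as Fin
open import Data.Fin.Patterns using (0F; 1F; 2F; 3F)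
open import Data.Fin.Properties using (<⇒notInjective)
open import Data.Fin.Permutation using (Permutation; permutation)
open import Data.Vec using (Vec; []; _∷_)
open import Data.Product using (Σ; ∃; ∃-syntax; _,_; proj₁; proj₂)
open import Data.Sum using (_⊎_; inj₁; inj₂)
open import Data.Empty using (⊥-elim)
open import Data.Maybe using (Maybe; just; nothing)
open import Relation.Nullary using (Dec; yes; no)
open import Relation.Nullary.Decidable using (map′; decidable-stable)
open import Relation.Binary.PropositionalEquality as ≡ using (_≡_)
open import Relation.Binary.Bundles using (Setoid)
import Relation.Binary.Reasoning.Setoid
open import Algebra.Bundles using (CommutativeRing)
import Algebra.Solver.Ring.AlmostCommutativeRing as ACR
import Algebra.Solver.Ring

-- P, S = S_{U,W} and E all consist of lower unitriangular 4×4 matrices, so we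
-- work in coordinates: such a matrix is determined by its six entries below
-- the diagonal, and the matrix product becomes an explicit group law on
-- six-tuples (checked entrywise by a ring solver with integer coefficients,
-- set up first for an arbitrary commutative ring).  An invariant of the
-- coordinates that holds on generators and is preserved by the group law
-- holds on the whole generated group.  The groups are then separated by
-- properties that isomorphisms reflect:
--   p odd:  in P and in E every commutator is central, but in S the
--           commutator of θ_u and t_{0,0,w} (0 ≠ w ∈ W) does not commute with
--           θ_u, as that would force 2 w u² = 0;
--   p = 2:  E is commutative while θ_u and t_{0,0,w} do not commute; and in S
--           the product of two elements with nontrivial squares squares to 1,
--           which fails in P for θ_α, θ_β with α, β the first two basis
--           vectors.
-- The arithmetic input: a field of size 2^f has characteristic 2 (summing
-- x + 1 over F), 2 ≠ 0 for p ≥ 3 and α, β, α + β ≠ 0 (independence of the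
-- basis), and W ≠ 0 because |F| = p^f > p.

module IntegerSolver {c ℓ : Level} (R : CommutativeRing c ℓ) where
  open CommutativeRing R
  open import Algebra.Properties.Ring ring
    using (-‿involutive; -‿distribˡ-*; -‿distribʳ-*; -0#≈0#; -‿+-comm)
  open import Algebra.Properties.Semiring.Mult.TCOptimised semiring
    using (1+×; ×-homo-+; ×1-homo-*) renaming (_×_ to _⨯_)
  open import Relation.Binary.Reasoning.Setoid setoid

  -- integers act through n ↦ n ⨯ 1# = 1# + … + 1#; with this definition
  -- 0 ↦ 0# and 1 ↦ 1# hold definitionally, so the solver's constants 0 and
  -- 1 evaluate to 0# and 1# on the nose
  ι : ℤ → Carrier
  ι (+ n)    = n ⨯ 1#
  ι -[1+ n ] = - (suc n ⨯ 1#)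

  x-0≈x : ∀ x → x - 0# ≈ x
  x-0≈x x = trans (+-congˡ -0#≈0#) (+-identityʳ x)

  [1+x]-[1+y]≈x-y : ∀ x y → (1# + x) - (1# + y) ≈ x - y
  [1+x]-[1+y]≈x-y x y = begin
    (1# + x) - (1# + y)      ≈⟨ +-cong (+-comm 1# x) (sym (-‿+-comm 1# y)) ⟩
    (x + 1#) + (- 1# - y)    ≈⟨ +-assoc x 1# (- 1# - y) ⟩
    x + (1# + (- 1# - y))    ≈⟨ +-congˡ (sym (+-assoc 1# (- 1#) (- y))) ⟩
    x + ((1# - 1#) - y)      ≈⟨ +-congˡ (+-congʳ (-‿inverseʳ 1#)) ⟩
    x + (0# - y)             ≈⟨ +-congˡ (+-identityˡ (- y)) ⟩
    x - y                    ∎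

  ι-⊖ : ∀ m n → ι (m ⊖ n) ≈ ι (+ m) - ι (+ n)
  ι-⊖ zero    zero    = sym (-‿inverseʳ 0#)
  ι-⊖ zero    (suc n) = sym (+-identityˡ _)
  ι-⊖ (suc m) zero    = sym (x-0≈x _)
  ι-⊖ (suc m) (suc n) = begin
    ι (suc m ⊖ suc n)                  ≡⟨ ≡.cong ι (ℤ.[1+m]⊖[1+n]≡m⊖n m n) ⟩
    ι (m ⊖ n)                          ≈⟨ ι-⊖ m n ⟩
    m ⨯ 1# - n ⨯ 1#                    ≈⟨ [1+x]-[1+y]≈x-y _ _ ⟨
    (1# + m ⨯ 1#) - (1# + n ⨯ 1#)      ≈⟨ +-cong (1+× m 1#) (-‿cong (1+× n 1#)) ⟨
    suc m ⨯ 1# - suc n ⨯ 1#            ∎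

  ι-+ : ∀ i j → ι (i ℤ.+ j) ≈ ι i + ι j
  ι-+ (+ m)    (+ n)    = ×-homo-+ 1# m n
  ι-+ (+ m)    -[1+ n ] = ι-⊖ m (suc n)
  ι-+ -[1+ m ] (+ n)    = trans (ι-⊖ n (suc m)) (+-comm _ _)
  ι-+ -[1+ m ] -[1+ n ] = begin
    - (suc (suc (m ℕ.+ n)) ⨯ 1#)       ≡⟨ ≡.cong (λ k → - (suc k ⨯ 1#)) (≡.sym (+-suc m n)) ⟩
    - ((suc m ℕ.+ suc n) ⨯ 1#)         ≈⟨ -‿cong (×-homo-+ 1# (suc m) (suc n)) ⟩
    - (suc m ⨯ 1# + suc n ⨯ 1#)        ≈⟨ -‿+-comm _ _ ⟨
    - (suc m ⨯ 1#) + - (suc n ⨯ 1#)    ∎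

  -- ℤ multiplies magnitudes and attaches a sign with _◃_
  ι-+◃ : ∀ n → ι (Sign.+ ◃ n) ≈ n ⨯ 1#
  ι-+◃ zero    = refl
  ι-+◃ (suc n) = refl

  ι--◃ : ∀ n → ι (Sign.- ◃ n) ≈ - (n ⨯ 1#)
  ι--◃ zero    = sym -0#≈0#
  ι--◃ (suc n) = refl

  ι-* : ∀ i j → ι (i ℤ.* j) ≈ ι i * ι j
  ι-* (+ m)    (+ n)    = trans (ι-+◃ (m ℕ.* n)) (×1-homo-* m n)
  ι-* (+ m)    -[1+ n ] = begin
    ι (Sign.- ◃ m ℕ.* suc n)        ≈⟨ ι--◃ (m ℕ.* suc n) ⟩
    - ((m ℕ.* suc n) ⨯ 1#)          ≈⟨ -‿cong (×1-homo-* m (suc n)) ⟩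
    - (m ⨯ 1# * (suc n ⨯ 1#))       ≈⟨ -‿distribʳ-* _ _ ⟩
    m ⨯ 1# * - (suc n ⨯ 1#)         ∎
  ι-* -[1+ m ] (+ n)    = begin
    ι (Sign.- ◃ suc m ℕ.* n)        ≈⟨ ι--◃ (suc m ℕ.* n) ⟩
    - ((suc m ℕ.* n) ⨯ 1#)          ≈⟨ -‿cong (×1-homo-* (suc m) n) ⟩
    - (suc m ⨯ 1# * n ⨯ 1#)         ≈⟨ -‿distribˡ-* _ _ ⟩
    - (suc m ⨯ 1#) * n ⨯ 1#         ∎
  ι-* -[1+ m ] -[1+ n ] = begin
    (suc m ℕ.* suc n) ⨯ 1#              ≈⟨ ×1-homo-* (suc m) (suc n) ⟩
    suc m ⨯ 1# * suc n ⨯ 1#             ≈⟨ -‿involutive _ ⟨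
    - - (suc m ⨯ 1# * suc n ⨯ 1#)       ≈⟨ -‿cong (-‿distribˡ-* _ _) ⟩
    - (- (suc m ⨯ 1#) * suc n ⨯ 1#)     ≈⟨ -‿distribʳ-* _ _ ⟩
    - (suc m ⨯ 1#) * - (suc n ⨯ 1#)     ∎

  ι-neg : ∀ i → ι (ℤ.- i) ≈ - ι i
  ι-neg (+ zero)  = sym -0#≈0#
  ι-neg (+ suc n) = refl
  ι-neg -[1+ n ]  = sym (-‿involutive _)

  ι-homomorphism : ℤ.+-*-rawRing ACR.-Raw-AlmostCommutative⟶ ACR.fromCommutativeRing R
  ι-homomorphism = record
    { ⟦_⟧ = ι ; +-homo = ι-+ ; *-homo = ι-* ; -‿homo = ι-neg ; 0-homo = refl ; 1-homo = refl }

  ι-equal? : ∀ i j → Maybe (ι i ≈ ι j)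
  ι-equal? i j with i ℤ.≟ j
  ... | yes ≡.refl = just refl
  ... | no _       = nothing

  open Algebra.Solver.Ring ℤ.+-*-rawRing (ACR.fromCommutativeRing R) ι-homomorphism ι-equal? public
    using (Polynomial; var; con; _:+_; _:*_; :-_; _:-_; _:=_; ⟦_⟧; ⟦_⟧↓; prove; solve)

  0ₚ 1ₚ : ∀ {n} → Polynomial n
  0ₚ = con (+ 0)
  1ₚ = con (+ 1)

p<p^f : ∀ p f → 2 ≤ p → 2 ≤ f → p ℕ.< p ^ f
p<p^f p f 2≤p 2≤f = ≡.subst (ℕ._< p ^ f) (*-identityʳ p) (^-monoʳ-< p 2≤p 2≤f)

-- The six entries x_ij (row i, column j) below the diagonal of a lower
-- unitriangular 4×4 matrix.
record UT6 {a} (A : Set a) : Set a where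
  constructor ut
  field x10 x20 x21 x30 x31 x32 : A
open UT6 public

-- It is instantiated with the field
-- operations and with the solver's polynomials, so that every identity of
-- the group law can be handed to the ring solver.
module UnitriangularLaw {a} {A : Set a} (_⊕_ _⊛_ : A → A → A) (⊝_ : A → A) (o l : A) where
  infixl 7 _∙_
  _∙_ : UT6 A → UT6 A → UT6 A
  ut a b c d e g ∙ ut a′ b′ c′ d′ e′ g′ =
    ut (a ⊕ a′) ((b ⊕ (c ⊛ a′)) ⊕ b′) (c ⊕ c′)
       (((d ⊕ (e ⊛ a′)) ⊕ (g ⊛ b′)) ⊕ d′) ((e ⊕ (g ⊛ c′)) ⊕ e′) (g ⊕ g′)

  infix 8 _⁻¹
  _⁻¹ : UT6 A → UT6 A
  ut a b c d e g ⁻¹ =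
    ut (⊝ a) ((⊝ b) ⊕ (c ⊛ a)) (⊝ c)
       (((⊝ d) ⊕ ((e ⊛ a) ⊕ (g ⊛ b))) ⊕ (⊝ ((g ⊛ c) ⊛ a))) ((⊝ e) ⊕ (g ⊛ c)) (⊝ g)

  ε : UT6 A
  ε = ut o o o o o o

  rowOf : A → A → A → A → Fin 4 → A
  rowOf a b c d 0F = a
  rowOf a b c d 1F = b
  rowOf a b c d 2F = c
  rowOf a b c d 3F = d

  matrix : UT6 A → Fin 4 → Fin 4 → A
  matrix m 0F = rowOf l o o o
  matrix m 1F = rowOf (x10 m) l o o
  matrix m 2F = rowOf (x20 m) (x21 m) l o
  matrix m 3F = rowOf (x30 m) (x31 m) (x32 m) l

  sum4 : (Fin 4 → A) → A
  sum4 v = v 0F ⊕ (v 1F ⊕ (v 2F ⊕ (v 3F ⊕ o)))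

  product : (Fin 4 → Fin 4 → A) → (Fin 4 → Fin 4 → A) → Fin 4 → Fin 4 → A
  product X Y i j = sum4 (λ k → X i k ⊛ Y k j)

module Groups {c ℓ : Level} (F : Field c ℓ) where
  open Field F using (commRing; 1≉0; inverse)
  open CommutativeRing commRing hiding (zero)
  open IntegerSolver commRing
  open import Algebra.Properties.Ring ring using (-‿involutive; -0#≈0#; -‿+-comm)
  open import Algebra.Properties.CommutativeMonoid.Sum +-commutativeMonoid
    using (sum; sum-cong-≋; ∑-comm; ∑-distrib-+; sum-permute; sum-replicate)
  open import Algebra.Properties.Semiring.Sum semiring using (*-distribˡ-sum; *-distribʳ-sum)
  open import Algebra.Properties.Semiring.Mult semiring using (×1-homo-*) renaming (_×_ to _⨯_)
  module ≈-Reasoning = Relation.Binary.Reasoning.Setoid setoid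

  nonzero-product : ∀ {x y} → ¬ (x ≈ 0#) → ¬ (y ≈ 0#) → ¬ (x * y ≈ 0#)
  nonzero-product {x} {y} x≉0 y≉0 xy≈0 =
    let x⁻¹ , xx⁻¹≈1 = inverse x x≉0
    in y≉0 (begin
      y               ≈⟨ *-identityˡ y ⟨
      1# * y          ≈⟨ *-congʳ xx⁻¹≈1 ⟨
      (x * x⁻¹) * y   ≈⟨ solve 3 (λ x x⁻¹ y → (x :* x⁻¹) :* y := x⁻¹ :* (x :* y)) refl x x⁻¹ y ⟩
      x⁻¹ * (x * y)   ≈⟨ *-congˡ xy≈0 ⟩
      x⁻¹ * 0#        ≈⟨ zeroʳ x⁻¹ ⟩
      0#              ∎)
    where open ≈-Reasoning

  difference-zero : ∀ {x y} → x ≈ y → x - y ≈ 0#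
  difference-zero {x} {y} x≈y = trans (+-congʳ x≈y) (-‿inverseʳ y)

  equal-if-difference-zero : ∀ {x y} → x - y ≈ 0# → x ≈ y
  equal-if-difference-zero {x} {y} x-y≈0 = begin
    x              ≈⟨ solve 2 (λ x y → x := (x :- y) :+ y) refl x y ⟩
    (x - y) + y    ≈⟨ +-congʳ x-y≈0 ⟩
    0# + y         ≈⟨ +-identityˡ y ⟩
    y              ∎
    where open ≈-Reasoning

  zero-difference : ∀ {x y} → x ≈ 0# → y ≈ 0# → x - y ≈ 0#
  zero-difference x≈0 y≈0 = difference-zero (trans x≈0 (sym y≈0))

  zero-product : ∀ {x} y → x ≈ 0# → x * y ≈ 0#
  zero-product y x≈0 = trans (*-congʳ x≈0) (zeroˡ y)

  zero-productʳ : ∀ x {y} → y ≈ 0# → x * y ≈ 0#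
  zero-productʳ x y≈0 = trans (*-congˡ y≈0) (zeroʳ x)

  -- (x + p) + y and (y + q) + x agree exactly when p and q do; this is the
  -- shape in which entries of u v and v u are compared
  rearrange : ∀ x y {p q} → p ≈ q → (x + p) + y ≈ (y + q) + x
  rearrange x y {p} {q} p≈q =
    trans (+-congʳ (+-congˡ p≈q)) (solve 3 (λ x y q → (x :+ q) :+ y := (y :+ q) :+ x) refl x y q)

  rearrange⁻¹ : ∀ x y {p q} → (x + p) + y ≈ (y + q) + x → p ≈ q
  rearrange⁻¹ x y {p} {q} eq = equal-if-difference-zero
    (trans (solve 4 (λ x y p q → p :- q := ((x :+ p) :+ y) :- ((y :+ q) :+ x)) refl x y p q) (difference-zero eq))

  Matrix : Set c
  Matrix = Mat F

  infixl 7 _⊙_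
  _⊙_ : Matrix → Matrix → Matrix
  A ⊙ B = _⊗_ F A B

  infix 4 _≋_
  _≋_ : Matrix → Matrix → Set ℓ
  A ≋ B = _≈M_ F A B

  𝟏 : Matrix
  𝟏 = I₄ F

  ≋-refl : ∀ {A} → A ≋ A
  ≋-refl i j = refl

  ≋-sym : ∀ {A B} → A ≋ B → B ≋ A
  ≋-sym A≋B i j = sym (A≋B i j)

  ≋-trans : ∀ {A B C} → A ≋ B → B ≋ C → A ≋ C
  ≋-trans A≋B B≋C i j = trans (A≋B i j) (B≋C i j)

  ≋-setoid : Setoid c ℓ
  ≋-setoid = record
    { Carrier = Matrix ; _≈_ = _≋_
    ; isEquivalence = record { refl = ≋-refl ; sym = ≋-sym ; trans = ≋-trans } }

  module ≋-Reasoning = Relation.Binary.Reasoning.Setoid ≋-setoid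

  ⊙-cong : ∀ {A A′ B B′} → A ≋ A′ → B ≋ B′ → A ⊙ B ≋ A′ ⊙ B′
  ⊙-cong A≋A′ B≋B′ i j = sum-cong-≋ {4} (λ k → *-cong (A≋A′ i k) (B≋B′ k j))

  ⊙-congˡ : ∀ A {B B′} → B ≋ B′ → A ⊙ B ≋ A ⊙ B′
  ⊙-congˡ A = ⊙-cong (≋-refl {A})

  ⊙-congʳ : ∀ B {A A′} → A ≋ A′ → A ⊙ B ≋ A′ ⊙ B
  ⊙-congʳ B A≋A′ = ⊙-cong A≋A′ (≋-refl {B})

  ⊙-assoc : ∀ A B C → (A ⊙ B) ⊙ C ≋ A ⊙ (B ⊙ C)
  ⊙-assoc A B C i j = begin
    sum (λ k → sum (λ l → A i l * B l k) * C k j)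
      ≈⟨ sum-cong-≋ {4} (λ k → *-distribʳ-sum (C k j) (λ l → A i l * B l k)) ⟩
    sum (λ k → sum (λ l → (A i l * B l k) * C k j))
      ≈⟨ ∑-comm {4} {4} (λ k l → (A i l * B l k) * C k j) ⟩
    sum (λ l → sum (λ k → (A i l * B l k) * C k j))
      ≈⟨ sum-cong-≋ {4} (λ l → sum-cong-≋ {4} (λ k → *-assoc (A i l) (B l k) (C k j))) ⟩
    sum (λ l → sum (λ k → A i l * (B l k * C k j)))
      ≈⟨ sum-cong-≋ {4} (λ l → *-distribˡ-sum (A i l) (λ k → B l k * C k j)) ⟨
    sum (λ l → A i l * sum (λ k → B l k * C k j))
      ∎
    where open ≈-Reasoning

  ⊙-identityʳ : ∀ A → A ⊙ 𝟏 ≋ A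
  ⊙-identityʳ A i 0F = solve 4 (λ a b c d → a :* 1ₚ :+ (b :* 0ₚ :+ (c :* 0ₚ :+ (d :* 0ₚ :+ 0ₚ))) := a)
                         refl (A i 0F) (A i 1F) (A i 2F) (A i 3F)
  ⊙-identityʳ A i 1F = solve 4 (λ a b c d → a :* 0ₚ :+ (b :* 1ₚ :+ (c :* 0ₚ :+ (d :* 0ₚ :+ 0ₚ))) := b)
                         refl (A i 0F) (A i 1F) (A i 2F) (A i 3F)
  ⊙-identityʳ A i 2F = solve 4 (λ a b c d → a :* 0ₚ :+ (b :* 0ₚ :+ (c :* 1ₚ :+ (d :* 0ₚ :+ 0ₚ))) := c)
                         refl (A i 0F) (A i 1F) (A i 2F) (A i 3F)
  ⊙-identityʳ A i 3F = solve 4 (λ a b c d → a :* 0ₚ :+ (b :* 0ₚ :+ (c :* 0ₚ :+ (d :* 1ₚ :+ 0ₚ))) := d)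
                         refl (A i 0F) (A i 1F) (A i 2F) (A i 3F)

  ⊙-identityˡ : ∀ A → 𝟏 ⊙ A ≋ A
  ⊙-identityˡ A 0F j = solve 4 (λ a b c d → 1ₚ :* a :+ (0ₚ :* b :+ (0ₚ :* c :+ (0ₚ :* d :+ 0ₚ))) := a)
                         refl (A 0F j) (A 1F j) (A 2F j) (A 3F j)
  ⊙-identityˡ A 1F j = solve 4 (λ a b c d → 0ₚ :* a :+ (1ₚ :* b :+ (0ₚ :* c :+ (0ₚ :* d :+ 0ₚ))) := b)
                         refl (A 0F j) (A 1F j) (A 2F j) (A 3F j)
  ⊙-identityˡ A 2F j = solve 4 (λ a b c d → 0ₚ :* a :+ (0ₚ :* b :+ (1ₚ :* c :+ (0ₚ :* d :+ 0ₚ))) := c)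
                         refl (A 0F j) (A 1F j) (A 2F j) (A 3F j)
  ⊙-identityˡ A 3F j = solve 4 (λ a b c d → 0ₚ :* a :+ (0ₚ :* b :+ (0ₚ :* c :+ (1ₚ :* d :+ 0ₚ))) := d)
                         refl (A 0F j) (A 1F j) (A 2F j) (A 3F j)

  left-inverse-unique : ∀ {M N M′} → N ⊙ M ≋ 𝟏 → M ⊙ M′ ≋ 𝟏 → N ≋ M′
  left-inverse-unique {M} {N} {M′} NM≋1 MM′≋1 = begin
    N              ≈⟨ ⊙-identityʳ N ⟨
    N ⊙ 𝟏          ≈⟨ ⊙-congˡ N MM′≋1 ⟨
    N ⊙ (M ⊙ M′)   ≈⟨ ⊙-assoc N M M′ ⟨
    (N ⊙ M) ⊙ M′   ≈⟨ ⊙-congʳ M′ NM≋1 ⟩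
    𝟏 ⊙ M′         ≈⟨ ⊙-identityˡ M′ ⟩
    M′             ∎
    where open ≋-Reasoning

  idempotent-is-identity : ∀ {A A′} → A ⊙ A ≋ A → A ⊙ A′ ≋ 𝟏 → A ≋ 𝟏
  idempotent-is-identity {A} {A′} AA≋A AA′≋1 = begin
    A              ≈⟨ ⊙-identityʳ A ⟨
    A ⊙ 𝟏          ≈⟨ ⊙-congˡ A AA′≋1 ⟨
    A ⊙ (A ⊙ A′)   ≈⟨ ⊙-assoc A A A′ ⟨
    (A ⊙ A) ⊙ A′   ≈⟨ ⊙-congʳ A′ AA≋A ⟩
    A ⊙ A′         ≈⟨ AA′≋1 ⟩
    𝟏              ∎
    where open ≋-Reasoning

  commutator-identity : ∀ {X Y X′ Y′} → X′ ⊙ X ≋ 𝟏 → Y′ ⊙ Y ≋ 𝟏 →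
                        (((X ⊙ Y) ⊙ X′) ⊙ Y′) ⊙ (Y ⊙ X) ≋ X ⊙ Y
  commutator-identity {X} {Y} {X′} {Y′} X′X≋1 Y′Y≋1 = begin
    (((X ⊙ Y) ⊙ X′) ⊙ Y′) ⊙ (Y ⊙ X)   ≈⟨ ⊙-assoc ((X ⊙ Y) ⊙ X′) Y′ (Y ⊙ X) ⟩
    ((X ⊙ Y) ⊙ X′) ⊙ (Y′ ⊙ (Y ⊙ X))   ≈⟨ ⊙-congˡ ((X ⊙ Y) ⊙ X′) (⊙-assoc Y′ Y X) ⟨
    ((X ⊙ Y) ⊙ X′) ⊙ ((Y′ ⊙ Y) ⊙ X)   ≈⟨ ⊙-congˡ ((X ⊙ Y) ⊙ X′) (⊙-congʳ X Y′Y≋1) ⟩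
    ((X ⊙ Y) ⊙ X′) ⊙ (𝟏 ⊙ X)          ≈⟨ ⊙-congˡ ((X ⊙ Y) ⊙ X′) (⊙-identityˡ X) ⟩
    ((X ⊙ Y) ⊙ X′) ⊙ X                ≈⟨ ⊙-assoc (X ⊙ Y) X′ X ⟩
    (X ⊙ Y) ⊙ (X′ ⊙ X)                ≈⟨ ⊙-congˡ (X ⊙ Y) X′X≋1 ⟩
    (X ⊙ Y) ⊙ 𝟏                       ≈⟨ ⊙-identityʳ (X ⊙ Y) ⟩
    X ⊙ Y                             ∎
    where open ≋-Reasoning

  UT : Set c
  UT = UT6 Carrier

  open UnitriangularLaw _+_ _*_ -_ 0# 1# public using (_∙_; _⁻¹; ε)
  module Poly {n : ℕ} = UnitriangularLaw (_:+_ {n}) _:*_ :-_ 0ₚ 1ₚ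

  mat : UT → Matrix
  mat m = rows F (row F 1# 0# 0# 0#) (row F (x10 m) 1# 0# 0#)
                 (row F (x20 m) (x21 m) 1# 0#) (row F (x30 m) (x31 m) (x32 m) 1#)

  infix 4 _≈ᵤ_
  _≈ᵤ_ : UT → UT → Set ℓ
  m ≈ᵤ n = (x10 m ≈ x10 n) × (x20 m ≈ x20 n) × (x21 m ≈ x21 n) ×
           (x30 m ≈ x30 n) × (x31 m ≈ x31 n) × (x32 m ≈ x32 n)

  row-cong : ∀ {a a′ b b′ c c′ d d′} → a ≈ a′ → b ≈ b′ → c ≈ c′ → d ≈ d′ →
             ∀ j → row F a b c d j ≈ row F a′ b′ c′ d′ j
  row-cong a≈ b≈ c≈ d≈ 0F = a≈
  row-cong a≈ b≈ c≈ d≈ 1F = b≈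
  row-cong a≈ b≈ c≈ d≈ 2F = c≈
  row-cong a≈ b≈ c≈ d≈ 3F = d≈

  mat-cong : ∀ {m n} → m ≈ᵤ n → mat m ≋ mat n
  mat-cong _                             0F = row-cong refl refl refl refl
  mat-cong (e10 , _)                     1F = row-cong e10 refl refl refl
  mat-cong (_ , e20 , e21 , _)           2F = row-cong e20 e21 refl refl
  mat-cong (_ , _ , _ , e30 , e31 , e32) 3F = row-cong e30 e31 e32 refl

  mat-injective : ∀ {m n} → mat m ≋ mat n → m ≈ᵤ n
  mat-injective m≋n = m≋n 1F 0F , m≋n 2F 0F , m≋n 2F 1F , m≋n 3F 0F , m≋n 3F 1F , m≋n 3F 2F

  mat-ε : mat ε ≋ 𝟏
  mat-ε = λ where
    0F 0F → refl ; 0F 1F → refl ; 0F 2F → refl ; 0F 3F → refl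
    1F 0F → refl ; 1F 1F → refl ; 1F 2F → refl ; 1F 3F → refl
    2F 0F → refl ; 2F 1F → refl ; 2F 2F → refl ; 2F 3F → refl
    3F 0F → refl ; 3F 1F → refl ; 3F 2F → refl ; 3F 3F → refl

  generic : ∀ {n} → Fin n → Fin n → Fin n → Fin n → Fin n → Fin n → UT6 (Polynomial n)
  generic i₁ i₂ i₃ i₄ i₅ i₆ = ut (var i₁) (var i₂) (var i₃) (var i₄) (var i₅) (var i₆)

  p₁ : UT6 (Polynomial 6)
  p₁ = generic (# 0) (# 1) (# 2) (# 3) (# 4) (# 5)

  p₂ q₂ : UT6 (Polynomial 12)
  p₂ = generic (# 0) (# 1) (# 2) (# 3) (# 4) (# 5)
  q₂ = generic (# 6) (# 7) (# 8) (# 9) (# 10) (# 11)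

  env₁ : UT → Vec Carrier 6
  env₁ m = x10 m ∷ x20 m ∷ x21 m ∷ x30 m ∷ x31 m ∷ x32 m ∷ []

  env₂ : UT → UT → Vec Carrier 12
  env₂ m n = x10 m ∷ x20 m ∷ x21 m ∷ x30 m ∷ x31 m ∷ x32 m ∷
             x10 n ∷ x20 n ∷ x21 n ∷ x30 n ∷ x31 n ∷ x32 n ∷ []

  mat-∙ : ∀ m n → mat m ⊙ mat n ≋ mat (m ∙ n)
  mat-∙ m n = λ where
      0F 0F → entry 0F 0F refl ; 0F 1F → entry 0F 1F refl ; 0F 2F → entry 0F 2F refl ; 0F 3F → entry 0F 3F refl
      1F 0F → entry 1F 0F refl ; 1F 1F → entry 1F 1F refl ; 1F 2F → entry 1F 2F refl ; 1F 3F → entry 1F 3F refl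
      2F 0F → entry 2F 0F refl ; 2F 1F → entry 2F 1F refl ; 2F 2F → entry 2F 2F refl ; 2F 3F → entry 2F 3F refl
      3F 0F → entry 3F 0F refl ; 3F 1F → entry 3F 1F refl ; 3F 2F → entry 3F 2F refl ; 3F 3F → entry 3F 3F refl
    where
    lhs rhs : Fin 4 → Fin 4 → Polynomial 12
    lhs = Poly.product (Poly.matrix p₂) (Poly.matrix q₂)
    rhs = Poly.matrix (p₂ Poly.∙ q₂)
    entry : ∀ i j → ⟦ lhs i j ⟧↓ (env₂ m n) ≈ ⟦ rhs i j ⟧↓ (env₂ m n) →
                    ⟦ lhs i j ⟧ (env₂ m n) ≈ ⟦ rhs i j ⟧ (env₂ m n)
    entry i j = prove (env₂ m n) (lhs i j) (rhs i j)

  coordinate-identity : ∀ m (l r : UT6 (Polynomial 6)) (π : UT6 (Polynomial 6) → Polynomial 6) →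
    ⟦ π l ⟧↓ (env₁ m) ≈ ⟦ π r ⟧↓ (env₁ m) → ⟦ π l ⟧ (env₁ m) ≈ ⟦ π r ⟧ (env₁ m)
  coordinate-identity m l r π = prove (env₁ m) (π l) (π r)

  ∙-inverseʳ : ∀ m → m ∙ m ⁻¹ ≈ᵤ ε
  ∙-inverseʳ m =
    let by = coordinate-identity m (p₁ Poly.∙ p₁ Poly.⁻¹) Poly.ε
    in by x10 refl , by x20 refl , by x21 refl , by x30 refl , by x31 refl , by x32 refl

  ∙-inverseˡ : ∀ m → m ⁻¹ ∙ m ≈ᵤ ε
  ∙-inverseˡ m =
    let by = coordinate-identity m (p₁ Poly.⁻¹ Poly.∙ p₁) Poly.ε
    in by x10 refl , by x20 refl , by x21 refl , by x30 refl , by x31 refl , by x32 refl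

  mat-inverseʳ : ∀ m → mat m ⊙ mat (m ⁻¹) ≋ 𝟏
  mat-inverseʳ m = ≋-trans (mat-∙ m (m ⁻¹)) (≋-trans (mat-cong (∙-inverseʳ m)) mat-ε)

  mat-inverseˡ : ∀ m → mat (m ⁻¹) ⊙ mat m ≋ 𝟏
  mat-inverseˡ m = ≋-trans (mat-∙ (m ⁻¹) m) (≋-trans (mat-cong (∙-inverseˡ m)) mat-ε)

  mat-∙-≋ : ∀ {m n M N} → mat m ≋ M → mat n ≋ N → mat (m ∙ n) ≋ M ⊙ N
  mat-∙-≋ {m} {n} m≋M n≋N = ≋-trans (≋-sym (mat-∙ m n)) (⊙-cong m≋M n≋N)

  ⊙-to-∙ : ∀ {x y x′ y′ X Y X′ Y′} → mat x ≋ X → mat y ≋ Y → mat x′ ≋ X′ → mat y′ ≋ Y′ →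
           X ⊙ Y ≋ X′ ⊙ Y′ → x ∙ y ≈ᵤ x′ ∙ y′
  ⊙-to-∙ x≋ y≋ x′≋ y′≋ eq =
    mat-injective (≋-trans (mat-∙-≋ x≋ y≋) (≋-trans eq (≋-sym (mat-∙-≋ x′≋ y′≋))))

  ∙-to-⊙ : ∀ {x y x′ y′ X Y X′ Y′} → mat x ≋ X → mat y ≋ Y → mat x′ ≋ X′ → mat y′ ≋ Y′ →
           x ∙ y ≈ᵤ x′ ∙ y′ → X ⊙ Y ≋ X′ ⊙ Y′
  ∙-to-⊙ x≋ y≋ x′≋ y′≋ eq =
    ≋-trans (≋-sym (mat-∙-≋ x≋ y≋)) (≋-trans (mat-cong eq) (mat-∙-≋ x′≋ y′≋))

  trivial-square : ∀ {m} → mat m ⊙ mat m ≋ 𝟏 → m ∙ m ≈ᵤ ε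
  trivial-square {m} m²≋1 = mat-injective (≋-trans (≋-sym (mat-∙ m m)) (≋-trans m²≋1 (≋-sym mat-ε)))

  Coordinates : ∀ {q} → (UT → Set q) → Matrix → Set (c ⊔ ℓ ⊔ q)
  Coordinates Q M = Σ UT λ m → mat m ≋ M × Q m

  -- An invariant of coordinates that holds for the generators and is
  -- preserved by the group operations holds on the whole generated group.
  -- (An inverse inside ⟨ X ⟩ is an arbitrary two-sided inverse matrix; it is
  -- identified with mat (m ⁻¹) by uniqueness of inverses.)
  coordinates : ∀ {a q} {X : Matrix → Set a} (Q : UT → Set q) →
                (∀ {M} → X M → Coordinates Q M) → Q ε →
                (∀ m n → Q m → Q n → Q (m ∙ n)) → (∀ m → Q m → Q (m ⁻¹)) →
                ∀ {M} → ⟨_⟩ F X M → Coordinates Q M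
  coordinates {X = X} Q generators Qε Q∙ Q⁻¹ = go
    where
    go : ∀ {M} → ⟨_⟩ F X M → Coordinates Q M
    go (gen x) = generators x
    go one = ε , mat-ε , Qε
    go (mul gM gN) =
      let m , m≋M , Qm = go gM
          n , n≋N , Qn = go gN
      in m ∙ n , mat-∙-≋ m≋M n≋N , Q∙ m n Qm Qn
    go (inv {M} gM _ NM≋1) =
      let m , m≋M , Qm = go gM
          M⊙m⁻¹≋1 = ≋-trans (⊙-congʳ (mat (m ⁻¹)) (≋-sym m≋M)) (mat-inverseʳ m)
      in m ⁻¹ , ≋-sym (left-inverse-unique {M} NM≋1 M⊙m⁻¹≋1) , Q⁻¹ m Qm
    go (resp M≋N gM) =
      let m , m≋M , Qm = go gM
      in m , ≋-trans m≋M M≋N , Qm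

  Closed : ∀ {a} → (Matrix → Set a) → Set (c ⊔ a)
  Closed G = ∀ {M N} → G M → G N → G (M ⊙ N)

  IsCommutative : ∀ {a} → (Matrix → Set a) → Set (c ⊔ ℓ ⊔ a)
  IsCommutative G = ∀ {M N} → G M → G N → M ⊙ N ≋ N ⊙ M

  -- every commutator W (an element with W (Y X) = X Y) is central
  CommutatorsCentral : ∀ {a} → (Matrix → Set a) → Set (c ⊔ ℓ ⊔ a)
  CommutatorsCentral G = ∀ {X Y Z W} → G X → G Y → G Z → G W →
                         W ⊙ (Y ⊙ X) ≋ X ⊙ Y → W ⊙ Z ≋ Z ⊙ W

  -- the product of two elements with nontrivial squares has trivial square;
  -- the identity appears as an idempotent I, so that transporting the
  -- property needs no separate argument that isomorphisms preserve 𝟏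
  NonInvolutionProducts : ∀ {a} → (Matrix → Set a) → Set (c ⊔ ℓ ⊔ a)
  NonInvolutionProducts G = ∀ {X Y I} → G X → G Y → G I → I ⊙ I ≋ I →
                            ¬ (X ⊙ X ≋ I) → ¬ (Y ⊙ Y ≋ I) → (X ⊙ Y) ⊙ (X ⊙ Y) ≋ I

  module Isomorphism {a b} {G : Matrix → Set a} {H : Matrix → Set b}
                     (iso : Iso F G H) (closed : Closed G) where
    φ : Σ Matrix G → Σ Matrix H
    φ = proj₁ iso

    ψ : Σ Matrix H → Σ Matrix G
    ψ = proj₁ (proj₂ iso)

    φ-cong : ∀ x y → proj₁ x ≋ proj₁ y → proj₁ (φ x) ≋ proj₁ (φ y)
    φ-cong = proj₁ (proj₂ (proj₂ iso))

    ψ-cong : ∀ x y → proj₁ x ≋ proj₁ y → proj₁ (ψ x) ≋ proj₁ (ψ y)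
    ψ-cong = proj₁ (proj₂ (proj₂ (proj₂ iso)))

    ψ∘φ : ∀ x → proj₁ (ψ (φ x)) ≋ proj₁ x
    ψ∘φ = proj₁ (proj₂ (proj₂ (proj₂ (proj₂ iso))))

    φ∘ψ : ∀ y → proj₁ (φ (ψ y)) ≋ proj₁ y
    φ∘ψ = proj₁ (proj₂ (proj₂ (proj₂ (proj₂ (proj₂ iso)))))

    φ̂ : ∀ {M} → G M → Matrix
    φ̂ g = proj₁ (φ (_ , g))

    φ̂∈H : ∀ {M} (g : G M) → H (φ̂ g)
    φ̂∈H g = proj₂ (φ (_ , g))

    φ̂-hom : ∀ {M N} (gM : G M) (gN : G N) → φ̂ (closed gM gN) ≋ φ̂ gM ⊙ φ̂ gN
    φ̂-hom gM gN = proj₂ (proj₂ (proj₂ (proj₂ (proj₂ (proj₂ iso))))) (_ , gM) (_ , gN) (_ , closed gM gN) ≋-refl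

    φ̂-injective : ∀ {M N} (gM : G M) (gN : G N) → φ̂ gM ≋ φ̂ gN → M ≋ N
    φ̂-injective gM gN eq = ≋-trans (≋-sym (ψ∘φ (_ , gM))) (≋-trans (ψ-cong (φ (_ , gM)) (φ (_ , gN)) eq) (ψ∘φ (_ , gN)))

    image-product-equation : ∀ {X₁ X₂ Y} (x₁ : G X₁) (x₂ : G X₂) (y : G Y) →
                             X₁ ⊙ X₂ ≋ Y → φ̂ x₁ ⊙ φ̂ x₂ ≋ φ̂ y
    image-product-equation x₁ x₂ y eq = ≋-trans (≋-sym (φ̂-hom x₁ x₂)) (φ-cong (_ , closed x₁ x₂) (_ , y) eq)

    product-equation : ∀ {X₁ X₂ Y} (x₁ : G X₁) (x₂ : G X₂) (y : G Y) →
                       φ̂ x₁ ⊙ φ̂ x₂ ≋ φ̂ y → X₁ ⊙ X₂ ≋ Y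
    product-equation x₁ x₂ y eq = φ̂-injective (closed x₁ x₂) y (≋-trans (φ̂-hom x₁ x₂) eq)

    commutative : IsCommutative H → IsCommutative G
    commutative comm gM gN =
      product-equation gM gN (closed gN gM) (≋-trans (comm (φ̂∈H gM) (φ̂∈H gN)) (≋-sym (φ̂-hom gN gM)))

    commutators-central : CommutatorsCentral H → CommutatorsCentral G
    commutators-central central gX gY gZ gW W[YX]≋XY =
      product-equation gW gZ (closed gZ gW)
        (≋-trans (central (φ̂∈H gX) (φ̂∈H gY) (φ̂∈H gZ) (φ̂∈H gW) image-hypothesis) (≋-sym (φ̂-hom gZ gW)))
      where
      image-hypothesis : φ̂ gW ⊙ (φ̂ gY ⊙ φ̂ gX) ≋ φ̂ gX ⊙ φ̂ gY
      image-hypothesis = ≋-trans (⊙-congˡ (φ̂ gW) (≋-sym (φ̂-hom gY gX)))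
                        (≋-trans (image-product-equation gW (closed gY gX) (closed gX gY) W[YX]≋XY)
                                 (φ̂-hom gX gY))

    non-involution-products : NonInvolutionProducts H → NonInvolutionProducts G
    non-involution-products products gX gY gI II≋I X²≉I Y²≉I =
      product-equation (closed gX gY) (closed gX gY) gI
        (≋-trans (⊙-cong (φ̂-hom gX gY) (φ̂-hom gX gY))
                 (products (φ̂∈H gX) (φ̂∈H gY) (φ̂∈H gI) (image-product-equation gI gI gI II≋I)
                           (λ eq → X²≉I (product-equation gX gX gI eq))
                           (λ eq → Y²≉I (product-equation gY gY gI eq))))

    symmetric : Iso F H G
    symmetric = ψ , φ , ψ-cong , φ-cong , φ∘ψ , ψ∘φ , ψ-hom
      where
      ψ-hom : ∀ x y xy → proj₁ xy ≋ proj₁ x ⊙ proj₁ y → proj₁ (ψ xy) ≋ proj₁ (ψ x) ⊙ proj₁ (ψ y)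
      ψ-hom x y xy xy≋x⊙y = ≋-sym (product-equation (proj₂ (ψ x)) (proj₂ (ψ y)) (proj₂ (ψ xy))
        (≋-trans (⊙-cong (φ∘ψ x) (φ∘ψ y)) (≋-trans (≋-sym xy≋x⊙y) (≋-sym (φ∘ψ xy)))))

  -- the quantities D₁, D₂ governing commutators of unitriangular matrices
  D₁ D₂ : UT → UT → Carrier
  D₁ x y = x21 x * x10 y - x21 y * x10 x
  D₂ x y = x32 x * x21 y - x32 y * x21 x

  -- Entries on the first
  -- subdiagonal simply add; entries (2,0) and (3,1) of a product follow the
  -- same rule, handled once by second-subdiagonal.
  commutator-shape : ∀ w x y → w ∙ (y ∙ x) ≈ᵤ x ∙ y →
    (x10 w ≈ 0#) × (x21 w ≈ 0#) × (x32 w ≈ 0#) × (x20 w ≈ D₁ x y) × (x31 w ≈ D₂ x y)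
  commutator-shape w x y (e10 , e20 , e21 , _ , e31 , e32) =
    first-subdiagonal e10 , first-subdiagonal e21 , first-subdiagonal e32 ,
    second-subdiagonal (first-subdiagonal e21) e20 , second-subdiagonal (first-subdiagonal e32) e31
    where
    first-subdiagonal : ∀ {a s t} → a + (s + t) ≈ t + s → a ≈ 0#
    first-subdiagonal {a} {s} {t} eq =
      trans (solve 3 (λ a s t → a := (a :+ (s :+ t)) :- (t :+ s)) refl a s t) (difference-zero eq)
    second-subdiagonal : ∀ {a₁ b₁ c₁ a₂ b₂ c₂ b c} → c ≈ 0# →
      (b + c * (a₂ + a₁)) + ((b₂ + c₂ * a₁) + b₁) ≈ (b₁ + c₁ * a₂) + b₂ → b ≈ c₁ * a₂ - c₂ * a₁
    second-subdiagonal {a₁} {b₁} {c₁} {a₂} {b₂} {c₂} {b} {c} c≈0 eq = equal-if-difference-zero (begin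
      b - (c₁ * a₂ - c₂ * a₁)
        ≈⟨ solve 8 (λ a₁ b₁ c₁ a₂ b₂ c₂ b c → b :- (c₁ :* a₂ :- c₂ :* a₁) :=
             ((b :+ c :* (a₂ :+ a₁)) :+ ((b₂ :+ c₂ :* a₁) :+ b₁) :- ((b₁ :+ c₁ :* a₂) :+ b₂)) :- c :* (a₂ :+ a₁))
             refl a₁ b₁ c₁ a₂ b₂ c₂ b c ⟩
      ((b + c * (a₂ + a₁)) + ((b₂ + c₂ * a₁) + b₁) - ((b₁ + c₁ * a₂) + b₂)) - c * (a₂ + a₁)
        ≈⟨ zero-difference (difference-zero eq) (zero-product (a₂ + a₁) c≈0) ⟩
      0# ∎)
      where open ≈-Reasoning

  -- entry (3,0) of a product, regrouped so that its two cross terms sit together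
  regroup : ∀ d p₁ p₂ d′ → ((d + p₁) + p₂) + d′ ≈ (d + (p₁ + p₂)) + d′
  regroup d p₁ p₂ d′ = +-congʳ (+-assoc d p₁ p₂)

  commutes-if : ∀ w z → x10 w ≈ 0# → x21 w ≈ 0# → x32 w ≈ 0# →
                x31 w * x10 z ≈ x32 z * x20 w → w ∙ z ≈ᵤ z ∙ w
  commutes-if w z a≈0 c≈0 g≈0 eq =
    +-comm (x10 w) (x10 z) ,
    rearrange (x20 w) (x20 z) (trans (zero-product (x10 z) c≈0) (sym (zero-productʳ (x21 z) a≈0))) ,
    +-comm (x21 w) (x21 z) ,
    trans (regroup (x30 w) _ _ (x30 z)) (trans (rearrange (x30 w) (x30 z) cross) (sym (regroup (x30 z) _ _ (x30 w)))) ,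
    rearrange (x31 w) (x31 z) (trans (zero-product (x21 z) g≈0) (sym (zero-productʳ (x32 z) c≈0))) ,
    +-comm (x32 w) (x32 z)
    where
    cross : x31 w * x10 z + x32 w * x20 z ≈ x31 z * x10 w + x32 z * x20 w
    cross = begin
      x31 w * x10 z + x32 w * x20 z   ≈⟨ +-cong eq (zero-product (x20 z) g≈0) ⟩
      x32 z * x20 w + 0#              ≈⟨ +-comm _ 0# ⟩
      0# + x32 z * x20 w              ≈⟨ +-congʳ (zero-productʳ (x31 z) a≈0) ⟨
      x31 z * x10 w + x32 z * x20 w   ∎
      where open ≈-Reasoning

  commutes-only-if : ∀ w z → x10 w ≈ 0# → x32 w ≈ 0# →
                     w ∙ z ≈ᵤ z ∙ w → x31 w * x10 z ≈ x32 z * x20 w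
  commutes-only-if w z a≈0 g≈0 (_ , _ , _ , e30 , _) = begin
    x31 w * x10 z                   ≈⟨ +-identityʳ _ ⟨
    x31 w * x10 z + 0#              ≈⟨ +-congˡ (zero-product (x20 z) g≈0) ⟨
    x31 w * x10 z + x32 w * x20 z   ≈⟨ rearrange⁻¹ (x30 w) (x30 z) (trans (sym (regroup (x30 w) _ _ (x30 z)))
                                                                     (trans e30 (regroup (x30 z) _ _ (x30 w)))) ⟩
    x31 z * x10 w + x32 z * x20 w   ≈⟨ +-congʳ (zero-productʳ (x31 z) a≈0) ⟩
    0# + x32 z * x20 w              ≈⟨ +-identityˡ _ ⟩
    x32 z * x20 w                   ∎
    where open ≈-Reasoning

  commutator-central-if : ∀ w x y z → w ∙ (y ∙ x) ≈ᵤ x ∙ y →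
                          D₂ x y * x10 z ≈ x32 z * D₁ x y → w ∙ z ≈ᵤ z ∙ w
  commutator-central-if w x y z commutator condition =
    let a≈0 , c≈0 , g≈0 , b≈D₁ , e≈D₂ = commutator-shape w x y commutator
    in commutes-if w z a≈0 c≈0 g≈0 (trans (*-congʳ e≈D₂) (trans condition (*-congˡ (sym b≈D₁))))

  commutator-central-only-if : ∀ w x y z → w ∙ (y ∙ x) ≈ᵤ x ∙ y →
                               w ∙ z ≈ᵤ z ∙ w → D₂ x y * x10 z ≈ x32 z * D₁ x y
  commutator-central-only-if w x y z commutator commutes =
    let a≈0 , _ , g≈0 , b≈D₁ , e≈D₂ = commutator-shape w x y commutator
    in trans (*-congʳ (sym e≈D₂)) (trans (commutes-only-if w z a≈0 g≈0 commutes) (*-congˡ b≈D₁))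

  commuting-D₁ : ∀ x y → x ∙ y ≈ᵤ y ∙ x → x21 x * x10 y ≈ x21 y * x10 x
  commuting-D₁ x y (_ , e20 , _) = rearrange⁻¹ (x20 x) (x20 y) e20

  vanishing-D-central : ∀ {a q} {G : Matrix → Set a} (Q : UT → Set q) →
    (∀ {M} → G M → Coordinates Q M) → (∀ {x y} → Q x → Q y → (D₁ x y ≈ 0#) × (D₂ x y ≈ 0#)) →
    CommutatorsCentral G
  vanishing-D-central Q coords vanish gX gY gZ gW W[YX]≋XY =
    let x , x≋X , Qx = coords gX
        y , y≋Y , Qy = coords gY
        z , z≋Z , _  = coords gZ
        w , w≋W , _  = coords gW
        D₁≈0 , D₂≈0  = vanish Qx Qy
        commutator   = ⊙-to-∙ w≋W (mat-∙-≋ y≋Y x≋X) x≋X y≋Y W[YX]≋XY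
    in ∙-to-⊙ w≋W z≋Z z≋Z w≋W (commutator-central-if w x y z commutator
         (trans (zero-product (x10 z) D₂≈0) (sym (zero-productʳ (x32 z) D₁≈0))))

  tᵤ : Carrier → Carrier → Carrier → UT
  tᵤ a b c′ = ut (- c′) b 0# a b c′

  θᵤ : Carrier → UT
  θᵤ α = ut (- α) (- (α * α)) α 0# 0# α

  -- E = { t_{a,b,c} }: all entries (2,1) vanish, hence so do D₁ and D₂
  E-coordinates : ∀ {M} → E F M → Coordinates (λ m → x21 m ≈ 0#) M
  E-coordinates (a , b , c′ , t≋M) = tᵤ a b c′ , t≋M , refl

  E-commutators-central : CommutatorsCentral (E F)
  E-commutators-central = vanishing-D-central (λ m → x21 m ≈ 0#) E-coordinates λ {x} {y} x21≈0 y21≈0 →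
    zero-difference (zero-product (x10 y) x21≈0) (zero-product (x10 x) y21≈0) ,
    zero-difference (zero-productʳ (x32 x) y21≈0) (zero-productʳ (x32 y) x21≈0)

  -- every element of P satisfies x21 = x32 = - x10, hence D₁ = D₂ = 0
  PShape : UT → Set ℓ
  PShape m = (x21 m ≈ - x10 m) × (x32 m ≈ - x10 m)

  P-coordinates : ∀ {f} (α : Fin f → Carrier) {M} → P F f α M → Coordinates PShape M
  P-coordinates α = coordinates PShape generator (sym -0#≈0# , sym -0#≈0#) product inverse′
    where
    generator : ∀ {M} → _∪_ F (R F) (λ M → ∃[ i ] (θ F (α i) ≋ M)) M → Coordinates PShape M
    generator (inj₁ (a , b , t≋M)) = tᵤ a b 0# , t≋M , sym (-‿involutive 0#) , sym (-‿involutive 0#)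
    generator (inj₂ (i , θ≋M))     = θᵤ (α i) , θ≋M , sym (-‿involutive _) , sym (-‿involutive _)
    product : ∀ m n → PShape m → PShape n → PShape (m ∙ n)
    product _ _ (c≈ , g≈) (c′≈ , g′≈) =
      trans (+-cong c≈ c′≈) (-‿+-comm _ _) , trans (+-cong g≈ g′≈) (-‿+-comm _ _)
    inverse′ : ∀ m → PShape m → PShape (m ⁻¹)
    inverse′ _ (c≈ , g≈) = -‿cong c≈ , -‿cong g≈

  P-commutators-central : ∀ {f} (α : Fin f → Carrier) → CommutatorsCentral (P F f α)
  P-commutators-central α = vanishing-D-central PShape (P-coordinates α) λ {x} {y} (c≈ , g≈) (c′≈ , g′≈) →
    difference-zero (begin
      x21 x * x10 y       ≈⟨ *-congʳ c≈ ⟩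
      - x10 x * x10 y     ≈⟨ solve 2 (λ a a′ → :- a :* a′ := :- a′ :* a) refl (x10 x) (x10 y) ⟩
      - x10 y * x10 x     ≈⟨ *-congʳ c′≈ ⟨
      x21 y * x10 x       ∎) ,
    difference-zero (begin
      x32 x * x21 y       ≈⟨ *-cong g≈ c′≈ ⟩
      - x10 x * - x10 y   ≈⟨ *-comm _ _ ⟩
      - x10 y * - x10 x   ≈⟨ *-cong g′≈ c≈ ⟨
      x32 y * x21 x       ∎)
    where open ≈-Reasoning

  CharacteristicTwo : Set (c ⊔ ℓ)
  CharacteristicTwo = ∀ x → x + x ≈ 0#

  square-entry : CharacteristicTwo → ∀ m → m ∙ m ≈ᵤ ε → x32 m * x21 m ≈ 0#
  square-entry char2 m (_ , _ , _ , _ , e31 , _) = begin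
    x32 m * x21 m                                        ≈⟨ solve 3 (λ e g c′ → g :* c′ := ((e :+ g :* c′) :+ e) :- (e :+ e))
                                                              refl (x31 m) (x32 m) (x21 m) ⟩
    ((x31 m + x32 m * x21 m) + x31 m) - (x31 m + x31 m)  ≈⟨ zero-difference e31 (char2 (x31 m)) ⟩
    0#                                                   ∎
    where open ≈-Reasoning

  P-non-involution-products-fail : CharacteristicTwo → ∀ {f} (α : Fin f → Carrier) (i j : Fin f) →
    ¬ (α i ≈ 0#) → ¬ (α j ≈ 0#) → ¬ (α i + α j ≈ 0#) → ¬ NonInvolutionProducts (P F f α)
  P-non-involution-products-fail char2 α i j αi≉0 αj≉0 αi+αj≉0 products =
    nonzero-product αi+αj≉0 αi+αj≉0 (square-entry char2 (θᵤ (α i) ∙ θᵤ (α j)) (trivial-square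
      (≋-trans (⊙-cong θθ≋ θθ≋) [θθ]²≋1)))
    where
    θθ≋ : mat (θᵤ (α i) ∙ θᵤ (α j)) ≋ θ F (α i) ⊙ θ F (α j)
    θθ≋ = ≋-sym (mat-∙ (θᵤ (α i)) (θᵤ (α j)))
    θ∈P : ∀ k → P F _ α (θ F (α k))
    θ∈P k = gen (inj₂ (k , ≋-refl))
    θ²≉1 : ∀ k → ¬ (α k ≈ 0#) → ¬ (θ F (α k) ⊙ θ F (α k) ≋ 𝟏)
    θ²≉1 k αk≉0 θ²≋1 = nonzero-product αk≉0 αk≉0 (square-entry char2 (θᵤ (α k)) (trivial-square θ²≋1))
    [θθ]²≋1 : (θ F (α i) ⊙ θ F (α j)) ⊙ (θ F (α i) ⊙ θ F (α j)) ≋ 𝟏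
    [θθ]²≋1 = products (θ∈P i) (θ∈P j) one (⊙-identityˡ 𝟏) (θ²≉1 i αi≉0) (θ²≉1 j αj≉0)

  -- in characteristic two E is commutative: the entries (3,0) of the two
  -- products differ by twice c b′ - b c′
  E-commutative : CharacteristicTwo → IsCommutative (E F)
  E-commutative char2 (a , b , c₁ , t≋M) (a′ , b′ , c₁′ , t′≋N) =
    ∙-to-⊙ t≋M t′≋N t′≋N t≋M
      ( +-comm (- c₁) (- c₁′)
      , rearrange b b′ (trans (zeroˡ (- c₁′)) (sym (zeroˡ (- c₁))))
      , +-comm 0# 0#
      , trans (regroup a _ _ a′) (trans (rearrange a a′ cross) (sym (regroup a′ _ _ a)))
      , rearrange b b′ (trans (zeroʳ c₁) (sym (zeroʳ c₁′)))
      , +-comm c₁ c₁′ )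
    where
    cross : b * - c₁′ + c₁ * b′ ≈ b′ * - c₁ + c₁′ * b
    cross = equal-if-difference-zero (trans
      (solve 4 (λ b c b′ c′ → (b :* :- c′ :+ c :* b′) :- (b′ :* :- c :+ c′ :* b) :=
                              (c :* b′ :- b :* c′) :+ (c :* b′ :- b :* c′)) refl b c₁ b′ c₁′)
      (char2 _))

  module OneDimensional (u : Carrier) (W : Carrier → Set ℓ) where
    S₁ : Matrix → Set (c ⊔ ℓ)
    S₁ = S F 1 (λ _ → u) W

    θu∈S : S₁ (θ F u)
    θu∈S = gen (inj₂ (inj₁ (0F , ≋-refl)))

    t∈S : ∀ {w} → W w → S₁ (t F 0# 0# w)
    t∈S Ww = gen (inj₂ (inj₂ (_ , Ww , ≋-refl)))

    inverse∈S : ∀ {m} → S₁ (mat m) → S₁ (mat (m ⁻¹))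
    inverse∈S {m} g = inv g (mat-inverseʳ m) (mat-inverseˡ m)

    S-noncommutative : ¬ (u ≈ 0#) → ∀ {w} → W w → ¬ (w ≈ 0#) → ¬ IsCommutative S₁
    S-noncommutative u≉0 {w} Ww w≉0 comm = nonzero-product u≉0 w≉0 (begin
      u * w            ≈⟨ solve 2 (λ u w → u :* w := :- (u :* :- w)) refl u w ⟩
      - (u * - w)      ≈⟨ -‿cong (commuting-D₁ (θᵤ u) (tᵤ 0# 0# w)
                            (⊙-to-∙ ≋-refl ≋-refl ≋-refl ≋-refl (comm θu∈S (t∈S Ww)))) ⟩
      - (0# * - u)     ≈⟨ -‿cong (zeroˡ (- u)) ⟩
      - 0#             ≈⟨ -0#≈0# ⟩
      0#               ∎)
      where open ≈-Reasoning

    -- The commutator k of x = θ_u and y = t_{0,0,w} does not commute with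
    -- θ_u when 2 w u² ≠ 0, since D₂ x y · x10 x - x32 x · D₁ x y = 2 w u².
    S-commutators-not-central : ¬ (1# + 1# ≈ 0#) → ¬ (u ≈ 0#) → ∀ {w} → W w → ¬ (w ≈ 0#) →
                                ¬ CommutatorsCentral S₁
    S-commutators-not-central 2≉0 u≉0 {w} Ww w≉0 central =
      nonzero-product 2≉0 (nonzero-product w≉0 (nonzero-product u≉0 u≉0)) (begin
        (1# + 1#) * (w * (u * u))
          ≈⟨ solve 2 (λ u w → (1ₚ :+ 1ₚ) :* (w :* (u :* u)) :=
                              (u :* 0ₚ :- w :* u) :* :- u :- u :* (u :* :- w :- 0ₚ :* :- u)) refl u w ⟩
        D₂ x y * x10 x - x32 x * D₁ x y
          ≈⟨ difference-zero (commutator-central-only-if k x y x k[yx]≈xy kx≈xk) ⟩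
        0# ∎)
      where
      open ≈-Reasoning
      x y k : UT
      x = θᵤ u
      y = tᵤ 0# 0# w
      k = ((x ∙ y) ∙ x ⁻¹) ∙ y ⁻¹
      K : Matrix
      K = ((mat x ⊙ mat y) ⊙ mat (x ⁻¹)) ⊙ mat (y ⁻¹)
      k≋K : mat k ≋ K
      k≋K = mat-∙-≋ (mat-∙-≋ (mat-∙-≋ {x} {y} ≋-refl ≋-refl) (≋-refl {mat (x ⁻¹)})) (≋-refl {mat (y ⁻¹)})
      K∈S : S₁ K
      K∈S = mul (mul (mul θu∈S (t∈S Ww)) (inverse∈S θu∈S)) (inverse∈S (t∈S Ww))
      K[YX]≋XY : K ⊙ (mat y ⊙ mat x) ≋ mat x ⊙ mat y
      K[YX]≋XY = commutator-identity {mat x} {mat y} {mat (x ⁻¹)} {mat (y ⁻¹)} (mat-inverseˡ x) (mat-inverseˡ y)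
      k[yx]≈xy : k ∙ (y ∙ x) ≈ᵤ x ∙ y
      k[yx]≈xy = ⊙-to-∙ {x′ = x} {y′ = y} k≋K (mat-∙-≋ {y} {x} ≋-refl ≋-refl) ≋-refl ≋-refl K[YX]≋XY
      kx≈xk : k ∙ x ≈ᵤ x ∙ k
      kx≈xk = ⊙-to-∙ {y = x} {x′ = x} k≋K ≋-refl ≋-refl k≋K (central θu∈S (t∈S Ww) θu∈S K∈S K[YX]≋XY)

    SShape : UT → Set ℓ
    SShape m = (x21 m ≈ 0# ⊎ x21 m ≈ u) × (x10 m ≈ - x32 m) × (x20 m - x31 m ≈ - (x21 m * x32 m))

    module CharacteristicTwoFacts (char2 : CharacteristicTwo) where
      neg-self : ∀ x → - x ≈ x
      neg-self x = trans (solve 1 (λ x → :- x := x :- (x :+ x)) refl x)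
                         (trans (+-congˡ (-‿cong (char2 x))) (trans (+-congˡ -0#≈0#) (+-identityʳ x)))

      Binary : Carrier → Set ℓ
      Binary x = x ≈ 0# ⊎ x ≈ u

      binary-+ : ∀ {x y} → Binary x → Binary y → Binary (x + y)
      binary-+ (inj₁ x≈0) (inj₁ y≈0) = inj₁ (trans (+-cong x≈0 y≈0) (+-identityʳ 0#))
      binary-+ (inj₁ x≈0) (inj₂ y≈u) = inj₂ (trans (+-cong x≈0 y≈u) (+-identityˡ u))
      binary-+ (inj₂ x≈u) (inj₁ y≈0) = inj₂ (trans (+-cong x≈u y≈0) (+-identityʳ u))
      binary-+ (inj₂ x≈u) (inj₂ y≈u) = inj₁ (trans (+-cong x≈u y≈u) (char2 u))

      binary-neg : ∀ {x} → Binary x → Binary (- x)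
      binary-neg (inj₁ x≈0) = inj₁ (trans (-‿cong x≈0) -0#≈0#)
      binary-neg (inj₂ x≈u) = inj₂ (trans (-‿cong x≈u) (neg-self u))

      -- the third SShape condition for elements with x21 = 0 and x20 = x31
      vanishing-difference : ∀ x y → x - x ≈ - (0# * y)
      vanishing-difference x y = trans (-‿inverseʳ x) (sym (trans (-‿cong (zeroˡ y)) -0#≈0#))

      SShape-∙ : ∀ m n → SShape m → SShape n → SShape (m ∙ n)
      SShape-∙ (ut a b c₁ d e g) (ut a′ b′ c₁′ d′ e′ g′) (c∈ , a≈ , b-e≈) (c′∈ , a′≈ , b′-e′≈) =
        binary-+ c∈ c′∈ , trans (+-cong a≈ a′≈) (-‿+-comm g g′) , (begin
          ((b + c₁ * a′) + b′) - ((e + g * c₁′) + e′)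
            ≈⟨ solve 9 (λ a′ b c b′ e g c′ e′ g′ →
                 ((b :+ c :* a′) :+ b′) :- ((e :+ g :* c′) :+ e′) :=
                 ((b :- e) :+ (b′ :- e′)) :+ (c :* a′ :- g :* c′)) refl a′ b c₁ b′ e g c₁′ e′ g′ ⟩
          ((b - e) + (b′ - e′)) + (c₁ * a′ - g * c₁′)
            ≈⟨ +-cong (+-cong b-e≈ b′-e′≈) (+-congʳ (*-congˡ a′≈)) ⟩
          (- (c₁ * g) + - (c₁′ * g′)) + (c₁ * - g′ - g * c₁′)
            ≈⟨ solve 4 (λ c g c′ g′ → (:- (c :* g) :+ :- (c′ :* g′)) :+ (c :* :- g′ :- g :* c′) :=
                                      :- ((c :+ c′) :* (g :+ g′))) refl c₁ g c₁′ g′ ⟩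
          - ((c₁ + c₁′) * (g + g′)) ∎)
        where open ≈-Reasoning

      SShape-⁻¹ : ∀ m → SShape m → SShape (m ⁻¹)
      SShape-⁻¹ (ut a b c₁ d e g) (c∈ , a≈ , b-e≈) = binary-neg c∈ , -‿cong a≈ , (begin
        (- b + c₁ * a) - (- e + g * c₁)
          ≈⟨ solve 5 (λ a b c e g → (:- b :+ c :* a) :- (:- e :+ g :* c) :=
                                    :- (b :- e) :+ (c :* a :- g :* c)) refl a b c₁ e g ⟩
        - (b - e) + (c₁ * a - g * c₁)
          ≈⟨ +-cong (-‿cong b-e≈) (+-congʳ (*-congˡ a≈)) ⟩
        - - (c₁ * g) + (c₁ * - g - g * c₁)
          ≈⟨ solve 2 (λ c g → :- :- (c :* g) :+ (c :* :- g :- g :* c) := :- (:- c :* :- g)) refl c₁ g ⟩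
        - (- c₁ * - g) ∎)
        where open ≈-Reasoning

      S-coordinates : ∀ {M} → S₁ M → Coordinates SShape M
      S-coordinates = coordinates SShape generator
        (inj₁ refl , sym -0#≈0# , vanishing-difference 0# 0#) SShape-∙ SShape-⁻¹
        where
        generator : ∀ {M} → _∪_ F (R F) (_∪_ F (λ M → ∃[ i ] (θ F ((λ _ → u) i) ≋ M))
                                              (λ M → ∃[ w ] (W w × t F 0# 0# w ≋ M))) M →
                    Coordinates SShape M
        generator (inj₁ (a , b , t≋M))        = tᵤ a b 0# , t≋M , inj₁ refl , refl , vanishing-difference b 0#
        generator (inj₂ (inj₁ (_ , θ≋M)))     = θᵤ u , θ≋M , inj₂ refl , refl , trans (+-congˡ -0#≈0#) (+-identityʳ _)
        generator (inj₂ (inj₂ (w , _ , t≋M))) = tᵤ 0# 0# w , t≋M , inj₁ refl , refl , vanishing-difference 0# w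

      S-square-trivial : ∀ m → SShape m → x21 m ≈ 0# → m ∙ m ≈ᵤ ε
      S-square-trivial (ut a b c₁ d e g) (_ , a≈ , b-e≈) c≈0 =
        char2 a ,
        trans (solve 3 (λ a b c → (b :+ c :* a) :+ b := (b :+ b) :+ c :* a) refl a b c₁)
              (trans (+-cong (char2 b) (zero-product a c≈0)) (+-identityʳ 0#)) ,
        char2 c₁ ,
        (begin
          ((d + e * a) + g * b) + d    ≈⟨ solve 5 (λ a b d e g → ((d :+ e :* a) :+ g :* b) :+ d :=
                                            (d :+ d) :+ (e :* a :+ g :* b)) refl a b d e g ⟩
          (d + d) + (e * a + g * b)    ≈⟨ +-cong (char2 d) (+-congʳ (*-congˡ a≈)) ⟩
          0# + (e * - g + g * b)       ≈⟨ +-congˡ (solve 3 (λ b e g → e :* :- g :+ g :* b := g :* (b :- e)) refl b e g) ⟩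
          0# + g * (b - e)             ≈⟨ +-congˡ (*-congˡ (trans b-e≈ (trans (-‿cong (zero-product g c≈0)) -0#≈0#))) ⟩
          0# + g * 0#                  ≈⟨ trans (+-identityˡ _) (zeroʳ g) ⟩
          0#                           ∎) ,
        trans (solve 3 (λ c e g → (e :+ g :* c) :+ e := (e :+ e) :+ g :* c) refl c₁ e g)
              (trans (+-cong (char2 e) (zero-productʳ g c≈0)) (+-identityʳ 0#)) ,
        char2 g
        where open ≈-Reasoning

      square-≋-𝟏 : ∀ {m M} → mat m ≋ M → SShape m → x21 m ≈ 0# → M ⊙ M ≋ 𝟏
      square-≋-𝟏 {m} m≋M shape c≈0 =
        ≋-trans (≋-sym (mat-∙-≋ m≋M m≋M)) (≋-trans (mat-cong (S-square-trivial m shape c≈0)) mat-ε)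

      nontrivial-square : ∀ {m M} → mat m ≋ M → SShape m → ¬ (M ⊙ M ≋ 𝟏) → x21 m ≈ u
      nontrivial-square m≋M (inj₁ c≈0 , shape) M²≉1 = ⊥-elim (M²≉1 (square-≋-𝟏 m≋M (inj₁ c≈0 , shape) c≈0))
      nontrivial-square m≋M (inj₂ c≈u , _)     _    = c≈u

      -- Two elements of S with nontrivial squares have x21 = u, so their
      -- product has x21 = u + u = 0 and squares to the identity.
      S-non-involution-products : NonInvolutionProducts S₁
      S-non-involution-products {X} {Y} {I} gX gY gI II≋I X²≉I Y²≉I =
        let x , x≋X , Sx = S-coordinates gX
            y , y≋Y , Sy = S-coordinates gY
            i , i≋I , _  = S-coordinates gI
            I≋𝟏   = idempotent-is-identity {I} {mat (i ⁻¹)} II≋I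
                      (≋-trans (⊙-congʳ (mat (i ⁻¹)) (≋-sym i≋I)) (mat-inverseʳ i))
            x21≈u = nontrivial-square x≋X Sx (λ X²≋1 → X²≉I (≋-trans X²≋1 (≋-sym I≋𝟏)))
            y21≈u = nontrivial-square y≋Y Sy (λ Y²≋1 → Y²≉I (≋-trans Y²≋1 (≋-sym I≋𝟏)))
        in ≋-trans (square-≋-𝟏 (mat-∙-≋ x≋X y≋Y) (SShape-∙ x y Sx Sy) (trans (+-cong x21≈u y21≈u) (char2 u)))
                   (≋-sym I≋𝟏)

  infixr 8 _⋅_
  _⋅_ : ℕ → Carrier → Carrier
  k ⋅ x = _·_ F k x

  decide-≈ : ∀ {n} → HasSize F n → ∀ x y → Dec (x ≈ y)
  decide-≈ (to , from , to-cong , from∘to , _) x y =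
    map′ (λ to≡ → trans (sym (from∘to x)) (trans (reflexive (≡.cong from to≡)) (from∘to y))) to-cong (to x Fin.≟ to y)

  -- The size n of F annihilates 1: translation by 1 permutes F, so
  -- Σ x = Σ (x + 1) = Σ x + n · 1.
  size-annihilates-one : ∀ {n} → HasSize F n → n ⨯ 1# ≈ 0#
  size-annihilates-one {n} (to , from , to-cong , from∘to , to∘from) = begin
    n ⨯ 1#                           ≈⟨ solve 2 (λ s k → k := (s :+ k) :- s) refl (sum from) (n ⨯ 1#) ⟩
    (sum from + n ⨯ 1#) - sum from   ≈⟨ +-congʳ Σ-invariant ⟨
    sum from - sum from              ≈⟨ -‿inverseʳ (sum from) ⟩
    0#                               ∎
    where
    open ≈-Reasoning
    shift unshift : Fin n → Fin n
    shift i = to (from i + 1#)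
    unshift i = to (from i - 1#)
    translation : Permutation n n
    translation = permutation shift unshift
      (λ i → ≡.trans (to-cong (trans (+-congʳ (from∘to _)) (solve 2 (λ x o → (x :- o) :+ o := x) refl (from i) 1#))) (to∘from i))
      (λ i → ≡.trans (to-cong (trans (+-congʳ (from∘to _)) (solve 2 (λ x o → (x :+ o) :- o := x) refl (from i) 1#))) (to∘from i))
    Σ-invariant : sum from ≈ sum from + n ⨯ 1#
    Σ-invariant = begin
      sum from                          ≈⟨ sum-permute from translation ⟩
      sum (λ i → from (shift i))        ≈⟨ sum-cong-≋ {n} (λ i → from∘to (from i + 1#)) ⟩
      sum (λ i → from i + 1#)           ≈⟨ ∑-distrib-+ {n} from (λ _ → 1#) ⟩
      sum from + sum {n} (λ _ → 1#)     ≈⟨ +-congˡ (sum-replicate n {1#}) ⟩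
      sum from + n ⨯ 1#                 ∎

  powers-of-two-nonzero : ¬ (1# + 1# ≈ 0#) → ∀ g → ¬ ((2 ℕ.^ g) ⨯ 1# ≈ 0#)
  powers-of-two-nonzero 2≉0 zero    1+0≈0 = 1≉0 (trans (sym (+-identityʳ 1#)) 1+0≈0)
  powers-of-two-nonzero 2≉0 (suc g) 2^[1+g]≈0 =
    nonzero-product (λ 1+[1+0]≈0 → 2≉0 (trans (+-congˡ (sym (+-identityʳ 1#))) 1+[1+0]≈0))
                    (powers-of-two-nonzero 2≉0 g) (trans (sym (×1-homo-* 2 (2 ℕ.^ g))) 2^[1+g]≈0)

  characteristic-two : ∀ f → HasSize F (2 ℕ.^ f) → CharacteristicTwo
  characteristic-two f size x = begin
    x + x               ≈⟨ solve 1 (λ x → x :+ x := (1ₚ :+ 1ₚ) :* x) refl x ⟩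
    (1# + 1#) * x       ≈⟨ zero-product x 2≈0 ⟩
    0#                  ∎
    where
    open ≈-Reasoning
    2≈0 : 1# + 1# ≈ 0#
    2≈0 = decidable-stable (decide-≈ size (1# + 1#) 0#)
            (λ 2≉0 → powers-of-two-nonzero 2≉0 f (size-annihilates-one size))

  module FirstTwoBasisVectors {p f : ℕ} (α : Fin (suc (suc f)) → Carrier)
                              (basis : IsBasis F (suc (suc p)) (suc (suc f)) α) where
    α₀ α₁ : Carrier
    α₀ = α 0F
    α₁ = α 1F

    pair : Fin (suc (suc p)) → Fin (suc (suc p)) → Fin (suc (suc f)) → Fin (suc (suc p))
    pair c₀ c₁ 0F            = c₀
    pair c₀ c₁ 1F            = c₁
    pair c₀ c₁ (suc (suc _)) = 0F

    sum-of-zeros : ∀ k → ∑ F k (λ _ → 0#) ≈ 0#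
    sum-of-zeros zero    = refl
    sum-of-zeros (suc k) = trans (+-identityˡ _) (sum-of-zeros k)

    independent : ∀ c₀ c₁ → Fin.toℕ c₀ ⋅ α₀ + Fin.toℕ c₁ ⋅ α₁ ≈ 0# → Fin.toℕ c₀ ≡ 0 × Fin.toℕ c₁ ≡ 0
    independent c₀ c₁ combination≈0 = vanishing 0F , vanishing 1F
      where
      vanishing : ∀ i → Fin.toℕ (pair c₀ c₁ i) ≡ 0
      vanishing = proj₁ basis (pair c₀ c₁)
        (trans (+-congˡ (trans (+-congˡ (sum-of-zeros f)) (+-identityʳ _))) combination≈0)

    1≢0 : ¬ (1 ≡ 0)
    1≢0 ()

    α₀≉0 : ¬ (α₀ ≈ 0#)
    α₀≉0 α₀≈0 = 1≢0 (proj₁ (independent 1F 0F (trans (+-identityʳ _) (trans (+-identityʳ _) α₀≈0))))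

    α₁≉0 : ¬ (α₁ ≈ 0#)
    α₁≉0 α₁≈0 = 1≢0 (proj₂ (independent 0F 1F (trans (+-identityˡ _) (trans (+-identityʳ _) α₁≈0))))

    α₀+α₁≉0 : ¬ (α₀ + α₁ ≈ 0#)
    α₀+α₁≉0 α₀+α₁≈0 =
      1≢0 (proj₁ (independent 1F 1F (trans (+-cong (+-identityʳ _) (+-identityʳ _)) α₀+α₁≈0)))

  -- for p ≥ 3 the combination 2 α₀ shows 2 ≠ 0 in F
  two-nonzero : ∀ {p f} (α : Fin (suc (suc f)) → Carrier) → IsBasis F (suc (suc (suc p))) (suc (suc f)) α →
                ¬ (1# + 1# ≈ 0#)
  two-nonzero α basis 2≈0 = 2≢0 (proj₁ (independent 2F 0F (begin
    α₀ + (α₀ + 0#) + 0#   ≈⟨ solve 1 (λ a → a :+ (a :+ 0ₚ) :+ 0ₚ := (1ₚ :+ 1ₚ) :* a) refl α₀ ⟩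
    (1# + 1#) * α₀        ≈⟨ zero-product α₀ 2≈0 ⟩
    0#                    ∎)))
    where
    open FirstTwoBasisVectors α basis
    open ≈-Reasoning
    2≢0 : ¬ (2 ≡ 0)
    2≢0 ()

  -- If F = ⟨u⟩ ⊕ W and |F| > p then W ≠ 0: otherwise x ↦ (the coefficient
  -- of x on u) would inject F into GF(p).
  complement-nontrivial : ∀ {p n} → HasSize F n → p ℕ.< n → ∀ {u} {W : Carrier → Set ℓ} →
                          IsDirectSum F (Span1 F p u) W → ¬ ¬ (∃ λ w → W w × ¬ (w ≈ 0#))
  complement-nontrivial {p} {n} size@(to , from , to-cong , _ , to∘from) p<n {u} {W} (decompose , _) no-witness =
    <⇒notInjective p<n coefficient-injective
    where
    W-zero : ∀ {w} → W w → w ≈ 0#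
    W-zero {w} Ww = decidable-stable (decide-≈ size w 0#) (λ w≉0 → no-witness (w , Ww , w≉0))
    coefficient : Fin n → Fin p
    coefficient i = proj₁ (proj₁ (proj₂ (proj₂ (decompose (from i)))))
    multiple : ∀ i → from i ≈ Fin.toℕ (coefficient i) ⋅ u
    multiple i =
      let v , w , (k , v≈ku) , Ww , from-i≈v+w = decompose (from i)
      in trans from-i≈v+w (trans (+-congˡ (W-zero Ww)) (trans (+-identityʳ v) v≈ku))
    coefficient-injective : ∀ {i j} → coefficient i ≡ coefficient j → i ≡ j
    coefficient-injective {i} {j} same = ≡.trans (≡.sym (to∘from i))
      (≡.trans (to-cong (trans (multiple i) (trans (reflexive (≡.cong (λ k → Fin.toℕ k ⋅ u) same)) (sym (multiple j)))))
               (to∘from j))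

  -- Characteristic two: P violates NonInvolutionProducts, which S satisfies;
  -- S is noncommutative while E is commutative.
  non-isomorphic-characteristic-two : ∀ {f} (α : Fin (suc (suc f)) → Carrier) →
    HasSize F (2 ℕ.^ suc (suc f)) → IsBasis F 2 (suc (suc f)) α →
    ∀ {u} → ¬ (u ≈ 0#) → ∀ (W : Carrier → Set ℓ) → IsDirectSum F (Span1 F 2 u) W →
    ¬ Iso F (P F _ α) (S F 1 (λ _ → u) W) × ¬ Iso F (S F 1 (λ _ → u) W) (E F)
  non-isomorphic-characteristic-two {f} α size basis {u} u≉0 W ⊕ =
    (λ P≅S → P-non-involution-products-fail char2 α 0F 1F α₀≉0 α₁≉0 α₀+α₁≉0
               (Isomorphism.non-involution-products P≅S mul S-non-involution-products)) ,
    (λ S≅E → complement-nontrivial size (p<p^f 2 (suc (suc f)) ≤-refl (s≤s (s≤s z≤n))) ⊕ λ (_ , Ww , w≉0) →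
               S-noncommutative u≉0 Ww w≉0 (Isomorphism.commutative S≅E mul (E-commutative char2)))
    where
    char2 : CharacteristicTwo
    char2 = characteristic-two (suc (suc f)) size
    open FirstTwoBasisVectors α basis
    open OneDimensional u W
    open CharacteristicTwoFacts char2

  -- Odd characteristic: commutators are central in P and E but not in S.
  non-isomorphic-odd : ∀ {p f} (α : Fin (suc (suc f)) → Carrier) →
    HasSize F (suc (suc (suc p)) ℕ.^ suc (suc f)) → IsBasis F (suc (suc (suc p))) (suc (suc f)) α →
    ∀ {u} → ¬ (u ≈ 0#) → ∀ (W : Carrier → Set ℓ) → IsDirectSum F (Span1 F (suc (suc (suc p))) u) W →
    ¬ Iso F (P F _ α) (S F 1 (λ _ → u) W) × ¬ Iso F (S F 1 (λ _ → u) W) (E F)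
  non-isomorphic-odd {p} {f} α size basis {u} u≉0 W ⊕ =
    (λ P≅S → not-central (Isomorphism.commutators-central (Isomorphism.symmetric P≅S mul) mul (P-commutators-central α))) ,
    (λ S≅E → not-central (Isomorphism.commutators-central S≅E mul E-commutators-central))
    where
    open OneDimensional u W
    not-central : ¬ CommutatorsCentral S₁
    not-central central =
      complement-nontrivial size (p<p^f (suc (suc (suc p))) (suc (suc f)) (s≤s (s≤s z≤n)) (s≤s (s≤s z≤n))) ⊕
        λ (_ , Ww , w≉0) → S-commutators-not-central (two-nonzero α basis) u≉0 Ww w≉0 central

-- The corollary: a prime p is 2 or at least 3, and f ≥ 2.
corollary3p16 : {c ℓ : Level} (F : Field c ℓ) (p f : ℕ) → Prime p → 2 ≤ f →
    HasSize F (p ^ f) →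
    (α : Fin f → Field.Carrier F) → IsBasis F p f α →
    (u : Field.Carrier F) → ¬ (Field._≈_ F u (Field.0# F)) →
    (W : Field.Carrier F → Set ℓ) → IsSubspace F W →
    IsDirectSum F (Span1 F p u) W →
    ¬ Iso F (P F f α) (S F 1 (λ _ → u) W) × ¬ Iso F (S F 1 (λ _ → u) W) (E F)
corollary3p16 F zero                _ p-prime _ _ _ _ _ _ _ _ _ = ⊥-elim (¬prime[0] p-prime)
corollary3p16 F (suc zero)          _ p-prime _ _ _ _ _ _ _ _ _ = ⊥-elim (¬prime[1] p-prime)
corollary3p16 F 2                   f _ (s≤s (s≤s _)) size α basis u u≉0 W _ ⊕ =
  Groups.non-isomorphic-characteristic-two F α size basis u≉0 W ⊕
corollary3p16 F (suc (suc (suc p))) f _ (s≤s (s≤s _)) size α basis u u≉0 W _ ⊕ =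
  Groups.non-isomorphic-odd F α size basis u≉0 W ⊕
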